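{- Let $\mathbb{M}$ be one of the modal systems $\mathsf{K},\mathsf{D},\mathsf{T},\mathsf{K4},\mathsf{S4}$. If $\vdash_{\mathbb{M}}A$, then the 2-sequent $\vdash A^{\langle\,\rangle}$ is provable in $2_{\mathbb{M}}$.
   Context: Hilbert systems: for a set $Z$ of modal formulas (over $\neg,\wedge,\vee,\to,\Box,\Diamond$), $\mathrm{K}Z$ is the smallest set of formulas containing $Z$, all instances of $A\to(B\to A)$, $(A\to(B\to C))\to((A\to B)\to(A\to C))$, $(\neg B\to\neg A)\to((\neg B\to A)\to B)$, $\Box(A\to B)\to(\Box A\to\Box B)$, and closed under modus ponens and necessitation (from $A$ infer $\Box A$). With $\mathbf D=\{\Box A\to\Diamond A\}$, $\mathbf T=\{\Box A\to A\}$, $\mathbf 4=\{\Box A\to\Box\Box A\}$ (all instances): $\mathsf K=\mathrm K\varnothing$, $\mathsf D=\mathrm K\mathbf D$, $\mathsf T=\mathrm K\mathbf T$, $\mathsf{K4}=\mathrm K\mathbf 4$, $\mathsf{S4}=\mathrm K\mathbf T\mathbf 4$; $\vdash_{\mathbb M}A$ means $A\in\mathbb M$. Fix a countably infinite set of tokens; a position is a finite (possibly empty) sequence of tokens, $\langle\,\rangle$ the empty one, $\circ$ concatenation, $\alpha\circ x=\alpha\circ\langle x\rangle$, $\beta\preceq\alpha$ means $\beta$ is a prefix of $\alpha$. A p-formula is $A^\alpha$ ($A$ modal formula, $\alpha$ position); a 2-sequent is $\Gamma\vdash\Delta$ with $\Gamma,\Delta$ finite (possibly empty) sequences of p-formulas;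 $I(\Gamma)=\{\beta:\exists A^\alpha\in\Gamma,\ \beta\preceq\alpha\}$. The calculus $2_{\mathsf{S4}}$: Axiom $A^\alpha\vdash A^\alpha$; Cut: from $\Gamma_1\vdash A^\alpha,\Delta_1$ and $\Gamma_2,A^\alpha\vdash\Delta_2$ infer $\Gamma_1,\Gamma_2\vdash\Delta_1,\Delta_2$; weakening, contraction, exchange on both sides; the classical propositional sequent rules for $\neg,\wedge,\vee,\to$ (two-premise rules with contexts joined) with all active p-formulas at the same position; modal rules: ($\Box\vdash$) from $\Gamma,A^{\alpha\circ\beta}\vdash\Delta$ infer $\Gamma,(\Box A)^\alpha\vdash\Delta$; ($\vdash\Box$) from $\Gamma\vdash A^{\alpha\circ x},\Delta$ infer $\Gamma\vdash(\Box A)^\alpha,\Delta$; ($\Diamond\vdash$) from $\Gamma,A^{\alpha\circ x}\vdash\Delta$ infer $\Gamma,(\Diamond A)^\alpha\vdash\Delta$; ($\vdash\Diamond$) from $\Gamma\vdash A^{\alpha\circ\beta},\Delta$ infer $\Gamma\vdash(\Diamond A)^\alpha,\Delta$; $\beta$ a position, $x$ a token, and in $\vdash\Box,\Diamond\vdash$ one requires $\alpha\circ x\notin I(\Gamma,\Delta)$. The calculi $2_{\mathsf T},2_{\mathsf D},2_{\mathsf{K4}},2_{\mathsf K}$ add constraints on $\Box\vdash,\vdash\Diamond$: $2_{\mathsf T}$: $\beta$ empty or a single token; $2_{\mathsf D}$: $\beta$ a single token; $2_{\mathsf{K4}}$: $\beta$ nonempty and $\Gamma$ or $\Delta$ contains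 some $B^{\alpha\circ\beta\circ\eta}$; $2_{\mathsf K}$: $\beta$ a single token and $\Gamma$ or $\Delta$ contains some $B^{\alpha\circ\beta\circ\eta}$. In $2_{\mathsf K},2_{\mathsf{K4}}$ Cut requires $\alpha\in I(\Gamma_1,\Delta_1)$ or $\alpha\in I(\Gamma_2,\Delta_2)$. -}

module Defs where

open import Data.Nat using (ℕ)
open import Data.List using (List; []; _∷_; _++_; [_])
open import Data.List.Membership.Propositional using (_∈_)
open import Data.List.Relation.Unary.All using (All)
open import Data.Product using (Σ; ∃; _×_; _,_; proj₂)
open import Data.Sum using (_⊎_)
open import Data.Unit using (⊤)
open import Relation.Nullary using (¬_)
open import Relation.Binary.PropositionalEquality using (_≡_)

infixr 5 _⇒_
infixr 6 _∨′_
infixr 7 _∧′_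

data Formula : Set where
  var  : ℕ → Formula
  ¬′_  : Formula → Formula
  _∧′_ : Formula → Formula → Formula
  _∨′_ : Formula → Formula → Formula
  _⇒_  : Formula → Formula → Formula
  □_   : Formula → Formula
  ◇_   : Formula → Formula

data Sys : Set where
  K D T K4 S4 : Sys

data ExtraAx : Sys → Formula → Set where
  axD   : ∀ A → ExtraAx D  (□ A ⇒ ◇ A)
  axT   : ∀ A → ExtraAx T  (□ A ⇒ A)
  ax4   : ∀ A → ExtraAx K4 (□ A ⇒ □ □ A)
  axS4T : ∀ A → ExtraAx S4 (□ A ⇒ A)
  axS44 : ∀ A → ExtraAx S4 (□ A ⇒ □ □ A)

data ⊢H (M : Sys) : Formula → Set where
  extra : ∀ {A} → ExtraAx M A → ⊢H M A
  ax1   : ∀ A B → ⊢H M (A ⇒ (B ⇒ A))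
  ax2   : ∀ A B C → ⊢H M ((A ⇒ (B ⇒ C)) ⇒ ((A ⇒ B) ⇒ (A ⇒ C)))
  ax3   : ∀ A B → ⊢H M ((¬′ B ⇒ ¬′ A) ⇒ ((¬′ B ⇒ A) ⇒ B))
  axK   : ∀ A B → ⊢H M (□ (A ⇒ B) ⇒ (□ A ⇒ □ B))
  mp    : ∀ {A B} → ⊢H M (A ⇒ B) → ⊢H M A → ⊢H M B
  nec   : ∀ {A} → ⊢H M A → ⊢H M (□ A)

Token : Set
Token = ℕ

Position : Set
Position = List Token

_≼_ : Position → Position → Set
β ≼ α = Σ Position (λ γ → β ++ γ ≡ α)

PFormula : Set
PFormula = Formula × Position

Ctx : Set
Ctx = List PFormula

InI : Position → Ctx → Set
InI β Γ = Σ PFormula (λ p → (p ∈ Γ) × (β ≼ proj₂ p))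

FreshIn : Position → Ctx → Set
FreshIn β Γ = ¬ InI β Γ

ModalOK : Sys → Position → Position → Ctx → Ctx → Set
ModalOK S4 α β Γ Δ = ⊤
ModalOK T  α β Γ Δ = (β ≡ []) ⊎ ∃ (λ (x : Token) → β ≡ [ x ])
ModalOK D  α β Γ Δ = ∃ (λ (x : Token) → β ≡ [ x ])
ModalOK K4 α β Γ Δ = (¬ (β ≡ [])) × InI (α ++ β) (Γ ++ Δ)
ModalOK K  α β Γ Δ = (∃ (λ (x : Token) → β ≡ [ x ])) × InI (α ++ β) (Γ ++ Δ)

CutOK : Sys → Position → Ctx → Ctx → Ctx → Ctx → Set
CutOK K  α Γ₁ Δ₁ Γ₂ Δ₂ = InI α (Γ₁ ++ Δ₁) ⊎ InI α (Γ₂ ++ Δ₂)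
CutOK K4 α Γ₁ Δ₁ Γ₂ Δ₂ = InI α (Γ₁ ++ Δ₁) ⊎ InI α (Γ₂ ++ Δ₂)
CutOK D  α Γ₁ Δ₁ Γ₂ Δ₂ = ⊤
CutOK T  α Γ₁ Δ₁ Γ₂ Δ₂ = ⊤
CutOK S4 α Γ₁ Δ₁ Γ₂ Δ₂ = ⊤

-- The calculus 2_M.  Derivable M Γ Δ  means  Γ ⊢ Δ  is provable in 2_M.
-- "Γ , A" is Γ ++ [ A ] (antecedent), "A , Δ" is A ∷ Δ (succedent).
data Derivable (M : Sys) : Ctx → Ctx → Set where
  axiom : ∀ A α → Derivable M [ (A , α) ] [ (A , α) ]
  cut   : ∀ {Γ₁ Δ₁ Γ₂ Δ₂ A α} → CutOK M α Γ₁ Δ₁ Γ₂ Δ₂ →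
          Derivable M Γ₁ ((A , α) ∷ Δ₁) → Derivable M (Γ₂ ++ [ (A , α) ]) Δ₂ →
          Derivable M (Γ₁ ++ Γ₂) (Δ₁ ++ Δ₂)
  wL : ∀ {Γ Δ} p → Derivable M Γ Δ → Derivable M (Γ ++ [ p ]) Δ
  wR : ∀ {Γ Δ} p → Derivable M Γ Δ → Derivable M Γ (p ∷ Δ)
  cL : ∀ {Γ Δ} p → Derivable M (Γ ++ p ∷ p ∷ []) Δ → Derivable M (Γ ++ [ p ]) Δ
  cR : ∀ {Γ Δ} p → Derivable M Γ (p ∷ p ∷ Δ) → Derivable M Γ (p ∷ Δ)
  xL : ∀ {Γ₁ Γ₂ Δ} p q → Derivable M (Γ₁ ++ p ∷ q ∷ Γ₂) Δ →
       Derivable M (Γ₁ ++ q ∷ p ∷ Γ₂) Δ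
  xR : ∀ {Γ Δ₁ Δ₂} p q → Derivable M Γ (Δ₁ ++ p ∷ q ∷ Δ₂) →
       Derivable M Γ (Δ₁ ++ q ∷ p ∷ Δ₂)
  ¬L : ∀ {Γ Δ A α} → Derivable M Γ ((A , α) ∷ Δ) →
       Derivable M (Γ ++ [ (¬′ A , α) ]) Δ
  ¬R : ∀ {Γ Δ A α} → Derivable M (Γ ++ [ (A , α) ]) Δ →
       Derivable M Γ ((¬′ A , α) ∷ Δ)
  ∧L₁ : ∀ {Γ Δ A B α} → Derivable M (Γ ++ [ (A , α) ]) Δ →
        Derivable M (Γ ++ [ (A ∧′ B , α) ]) Δ
  ∧L₂ : ∀ {Γ Δ A B α} → Derivable M (Γ ++ [ (B , α) ]) Δ →
        Derivable M (Γ ++ [ (A ∧′ B , α) ]) Δ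
  ∧R : ∀ {Γ₁ Δ₁ Γ₂ Δ₂ A B α} →
       Derivable M Γ₁ ((A , α) ∷ Δ₁) → Derivable M Γ₂ ((B , α) ∷ Δ₂) →
       Derivable M (Γ₁ ++ Γ₂) ((A ∧′ B , α) ∷ (Δ₁ ++ Δ₂))
  ∨L : ∀ {Γ₁ Δ₁ Γ₂ Δ₂ A B α} →
       Derivable M (Γ₁ ++ [ (A , α) ]) Δ₁ → Derivable M (Γ₂ ++ [ (B , α) ]) Δ₂ →
       Derivable M ((Γ₁ ++ Γ₂) ++ [ (A ∨′ B , α) ]) (Δ₁ ++ Δ₂)
  ∨R₁ : ∀ {Γ Δ A B α} → Derivable M Γ ((A , α) ∷ Δ) →
        Derivable M Γ ((A ∨′ B , α) ∷ Δ)
  ∨R₂ : ∀ {Γ Δ A B α} → Derivable M Γ ((B , α) ∷ Δ) →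
        Derivable M Γ ((A ∨′ B , α) ∷ Δ)
  ⇒L : ∀ {Γ₁ Δ₁ Γ₂ Δ₂ A B α} →
       Derivable M Γ₁ ((A , α) ∷ Δ₁) → Derivable M (Γ₂ ++ [ (B , α) ]) Δ₂ →
       Derivable M ((Γ₁ ++ Γ₂) ++ [ (A ⇒ B , α) ]) (Δ₁ ++ Δ₂)
  ⇒R : ∀ {Γ Δ A B α} → Derivable M (Γ ++ [ (A , α) ]) ((B , α) ∷ Δ) →
       Derivable M Γ ((A ⇒ B , α) ∷ Δ)
  □L : ∀ {Γ Δ A α β} → ModalOK M α β Γ Δ →
       Derivable M (Γ ++ [ (A , α ++ β) ]) Δ →
       Derivable M (Γ ++ [ (□ A , α) ]) Δ
  □R : ∀ {Γ Δ A α} (x : Token) → FreshIn (α ++ [ x ]) (Γ ++ Δ) →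
       Derivable M Γ ((A , α ++ [ x ]) ∷ Δ) →
       Derivable M Γ ((□ A , α) ∷ Δ)
  ◇L : ∀ {Γ Δ A α} (x : Token) → FreshIn (α ++ [ x ]) (Γ ++ Δ) →
       Derivable M (Γ ++ [ (A , α ++ [ x ]) ]) Δ →
       Derivable M (Γ ++ [ (◇ A , α) ]) Δ
  ◇R : ∀ {Γ Δ A α β} → ModalOK M α β Γ Δ →
       Derivable M Γ ((A , α ++ β) ∷ Δ) →
       Derivable M Γ ((◇ A , α) ∷ Δ)

-- The proof is by induction on the Hilbert derivation, but the statement
-- must first be generalised from the empty position to an arbitrary
-- position α: necessitation turns a proof of A into one of □A, and the
-- 2-sequent proof of □A^α needs A at the fresh position α ∘ x.
module Submission where

open import Defs
open import Data.List using ([]; _∷_; [_]; _++_)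
open import Data.List.Properties using (++-identityʳ; ++-identityʳ-unique; ++-assoc)
open import Data.List.Relation.Unary.Any using (here; there)
open import Data.List.Relation.Unary.All using (All; lookup) renaming ([] to []ᴬ; _∷_ to _∷ᴬ_)
open import Data.List.Membership.Propositional using (_∈_)
open import Data.Product using (_,_; proj₂)
open import Data.Sum using (inj₁; inj₂)
open import Data.Unit using (tt)
open import Relation.Nullary using (¬_)
open import Relation.Binary.PropositionalEquality using (_≡_; refl; sym; trans; subst)

≼-refl : (α : Position) → α ≼ α
≼-refl α = [] , ++-identityʳ α

occupied : ∀ {A α} {Γ : Ctx} → (A , α) ∈ Γ → InI α Γ
occupied {A} {α} A∈Γ = (A , α) , A∈Γ , ≼-refl α

extension-not-prefix : ∀ (α : Position) x γ → ¬ ((α ++ [ x ]) ++ γ ≡ α)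
extension-not-prefix α x γ eq with ++-identityʳ-unique α (sym (trans (sym (++-assoc α [ x ] γ)) eq))
... | ()

fresh-successor : ∀ α x (Γ : Ctx) → All (λ p → proj₂ p ≡ α) Γ → FreshIn (α ++ [ x ]) Γ
fresh-successor α x Γ atα (p , p∈Γ , γ , eq) with lookup atα p∈Γ
... | refl = extension-not-prefix α x γ eq

one-step-ok : ∀ M α x Γ Δ → InI (α ++ [ x ]) (Γ ++ Δ) → ModalOK M α [ x ] Γ Δ
one-step-ok K  α x Γ Δ occ = (x , refl) , occ
one-step-ok D  α x Γ Δ occ = x , refl
one-step-ok T  α x Γ Δ occ = inj₂ (x , refl)
one-step-ok K4 α x Γ Δ occ = (λ ()) , occ
one-step-ok S4 α x Γ Δ occ = tt

cut-ok : ∀ M α Γ₁ Δ₁ Γ₂ Δ₂ → InI α (Γ₂ ++ Δ₂) → CutOK M α Γ₁ Δ₁ Γ₂ Δ₂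
cut-ok K  α Γ₁ Δ₁ Γ₂ Δ₂ occ = inj₂ occ
cut-ok K4 α Γ₁ Δ₁ Γ₂ Δ₂ occ = inj₂ occ
cut-ok D  α Γ₁ Δ₁ Γ₂ Δ₂ occ = tt
cut-ok T  α Γ₁ Δ₁ Γ₂ Δ₂ occ = tt
cut-ok S4 α Γ₁ Δ₁ Γ₂ Δ₂ occ = tt

-- A system is reflexive if □L / ◇R may stay at the current position
-- (this validates □A → A), ...
ReflexiveSys : Sys → Set
ReflexiveSys M = ∀ α Γ Δ → ModalOK M α [] Γ Δ

-- ... and transitive if they may jump any nonempty distance to an occupied
-- position (this validates □A → □□A).
TransitiveSys : Sys → Set
TransitiveSys M = ∀ α β Γ Δ → ¬ (β ≡ []) → InI (α ++ β) (Γ ++ Δ) → ModalOK M α β Γ Δ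

T-reflexive : ReflexiveSys T
T-reflexive α Γ Δ = inj₁ refl

S4-reflexive : ReflexiveSys S4
S4-reflexive α Γ Δ = tt

K4-transitive : TransitiveSys K4
K4-transitive α β Γ Δ β≢[] occ = β≢[] , occ

S4-transitive : TransitiveSys S4
S4-transitive α β Γ Δ β≢[] occ = tt

module Derivations {M : Sys} where

  move-left : ∀ Γ₁ Σ p Γ₂ {Δ} → Derivable M (Γ₁ ++ Σ ++ p ∷ Γ₂) Δ →
              Derivable M (Γ₁ ++ p ∷ Σ ++ Γ₂) Δ
  move-left Γ₁ []      p Γ₂ d = d
  move-left Γ₁ (q ∷ Σ) p Γ₂ {Δ} d =
    xL {Γ₁ = Γ₁} {Γ₂ = Σ ++ Γ₂} q p (reassoc (move-left (Γ₁ ++ [ q ]) Σ p Γ₂ (reassoc' d)))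
    where
    reassoc : ∀ {Λ} → Derivable M ((Γ₁ ++ [ q ]) ++ Λ) Δ → Derivable M (Γ₁ ++ q ∷ Λ) Δ
    reassoc {Λ} = subst (λ Θ → Derivable M Θ Δ) (++-assoc Γ₁ [ q ] Λ)
    reassoc' : ∀ {Λ} → Derivable M (Γ₁ ++ q ∷ Λ) Δ → Derivable M ((Γ₁ ++ [ q ]) ++ Λ) Δ
    reassoc' {Λ} = subst (λ Θ → Derivable M Θ Δ) (sym (++-assoc Γ₁ [ q ] Λ))

  derive-ax1 : ∀ A B α → Derivable M [] [ (A ⇒ (B ⇒ A) , α) ]
  derive-ax1 A B α = ⇒R {Γ = []} (⇒R {Γ = [ (A , α) ]} (wL {Γ = [ (A , α) ]} (B , α) (axiom A α)))

  -- (A → (B → C)) → ((A → B) → (A → C)): from A, A, A→B, A→(B→C) ⊢ C by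
  -- three ⇒L steps, then reorder the antecedent and contract the two A's.
  derive-ax2 : ∀ A B C α → Derivable M [] [ ((A ⇒ (B ⇒ C)) ⇒ ((A ⇒ B) ⇒ (A ⇒ C)) , α) ]
  derive-ax2 A B C α =
    ⇒R {Γ = []} (⇒R {Γ = [ X ]} (⇒R {Γ = X ∷ Y ∷ []} (cL {Γ = X ∷ Y ∷ []} a
      (move-left [ X ] (a ∷ a ∷ []) Y [] (move-left [] (a ∷ a ∷ Y ∷ []) X [] reordered)))))
    where
    a = (A , α)
    Y = (A ⇒ B , α)
    X = (A ⇒ (B ⇒ C) , α)
    getB : Derivable M (a ∷ Y ∷ []) [ (B , α) ]
    getB = ⇒L {Γ₁ = [ a ]} {Δ₁ = []} {Γ₂ = []} (axiom A α) (axiom B α)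
    getC : Derivable M (a ∷ Y ∷ (B ⇒ C , α) ∷ []) [ (C , α) ]
    getC = ⇒L {Γ₁ = a ∷ Y ∷ []} {Δ₁ = []} {Γ₂ = []} getB (axiom C α)
    reordered : Derivable M (a ∷ a ∷ Y ∷ X ∷ []) [ (C , α) ]
    reordered = ⇒L {Γ₁ = [ a ]} {Δ₁ = []} {Γ₂ = a ∷ Y ∷ []} (axiom A α) getC

  -- (¬B → ¬A) → ((¬B → A) → B): both implications are used with the
  -- premise ¬B, which holds classically against the conclusion B.
  derive-ax3 : ∀ A B α → Derivable M [] [ ((¬′ B ⇒ ¬′ A) ⇒ ((¬′ B ⇒ A) ⇒ B) , α) ]
  derive-ax3 A B α =
    ⇒R {Γ = []} (⇒R {Γ = [ P ]} (cR {Γ = P ∷ Q ∷ []} {Δ = []} (B , α)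
      (⇒L {Γ₁ = []} {Δ₁ = [ (B , α) ]} {Γ₂ = [ P ]} {Δ₂ = [ (B , α) ]} notB-or-B fromP)))
    where
    P = (¬′ B ⇒ ¬′ A , α)
    Q = (¬′ B ⇒ A , α)
    notB-or-B : Derivable M [] ((¬′ B , α) ∷ (B , α) ∷ [])
    notB-or-B = ¬R {Γ = []} (axiom B α)
    A-and-notA : Derivable M ((A , α) ∷ (¬′ A , α) ∷ []) []
    A-and-notA = ¬L {Γ = [ (A , α) ]} (axiom A α)
    fromP : Derivable M (P ∷ (A , α) ∷ []) [ (B , α) ]
    fromP = xL {Γ₁ = []} {Γ₂ = []} (A , α) P
      (⇒L {Γ₁ = []} {Δ₁ = [ (B , α) ]} {Γ₂ = [ (A , α) ]} {Δ₂ = []} notB-or-B A-and-notA)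

  -- □(A → B) → (□A → □B): pick a fresh successor position α ∘ 0 for □B,
  -- then instantiate both boxes there (a single occupied token step).
  derive-axK : ∀ A B α → Derivable M [] [ (□ (A ⇒ B) ⇒ (□ A ⇒ □ B) , α) ]
  derive-axK A B α =
    ⇒R {Γ = []} (⇒R {Γ = [ P ]} (□R {Γ = P ∷ Q ∷ []} {Δ = []} 0
      (fresh-successor α 0 (P ∷ Q ∷ []) (refl ∷ᴬ refl ∷ᴬ []ᴬ)) openBoth))
    where
    γ = α ++ [ 0 ]
    P = (□ (A ⇒ B) , α)
    Q = (□ A , α)
    atγ : Derivable M ((A , γ) ∷ (A ⇒ B , γ) ∷ []) [ (B , γ) ]
    atγ = ⇒L {Γ₁ = [ (A , γ) ]} {Δ₁ = []} {Γ₂ = []} (axiom A γ) (axiom B γ)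
    openP : Derivable M ((A , γ) ∷ P ∷ []) [ (B , γ) ]
    openP = □L {Γ = [ (A , γ) ]} {Δ = [ (B , γ) ]} {β = [ 0 ]}
      (one-step-ok M α 0 [ (A , γ) ] [ (B , γ) ] (occupied (here refl))) atγ
    openBoth : Derivable M (P ∷ Q ∷ []) [ (B , γ) ]
    openBoth = □L {Γ = [ P ]} {Δ = [ (B , γ) ]} {β = [ 0 ]}
      (one-step-ok M α 0 [ P ] [ (B , γ) ] (occupied (there (here refl))))
      (xL {Γ₁ = []} {Γ₂ = []} (A , γ) P openP)

  -- Modus ponens is a cut on A → B at the common position α.
  derived-mp : ∀ A B α → Derivable M [] [ (A ⇒ B , α) ] → Derivable M [] [ (A , α) ] →
               Derivable M [] [ (B , α) ]
  derived-mp A B α ⊢A⇒B ⊢A =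
    cut {Γ₁ = []} {Δ₁ = []} {Γ₂ = []} {Δ₂ = [ (B , α) ]}
      (cut-ok M α [] [] [] [ (B , α) ] (occupied (here refl))) ⊢A⇒B
      (⇒L {Γ₁ = []} {Δ₁ = []} {Γ₂ = []} ⊢A (axiom B α))

  -- Necessitation is □R with an empty context, where every position is fresh.
  derived-nec : ∀ A α → Derivable M [] [ (A , α ++ [ 0 ]) ] → Derivable M [] [ (□ A , α) ]
  derived-nec A α ⊢A = □R {Γ = []} {Δ = []} 0 (λ { (_ , () , _) }) ⊢A

  -- □A → A holds in reflexive systems: instantiate the box at α itself.
  derive-axT : ReflexiveSys M → ∀ A α → Derivable M [] [ (□ A ⇒ A , α) ]
  derive-axT refl-M A α = ⇒R {Γ = []} (□L {Γ = []} {Δ = [ (A , α) ]} {β = []} (refl-M α [] _) ax)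
    where
    ax : Derivable M [ (A , α ++ []) ] [ (A , α) ]
    ax = subst (λ δ → Derivable M [ (A , α ++ []) ] [ (A , δ) ]) (++-identityʳ α) (axiom A (α ++ []))

  -- □A → □□A holds in transitive systems: two □R steps reach α ∘ 0 ∘ 1,
  -- and the hypothesis □A^α is instantiated there in one jump.
  derive-ax4 : TransitiveSys M → ∀ A α → Derivable M [] [ (□ A ⇒ □ (□ A) , α) ]
  derive-ax4 trans-M A α =
    ⇒R {Γ = []} (□R {Γ = [ P ]} {Δ = []} 0 (fresh-successor α 0 [ P ] (refl ∷ᴬ []ᴬ))
      (□R {Γ = [ P ]} {Δ = []} 1 fresh₁ atγ₁))
    where
    P = (□ A , α)
    γ = α ++ [ 0 ]
    δ = α ++ (0 ∷ 1 ∷ [])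
    atδ : Derivable M [ P ] [ (A , δ) ]
    atδ = □L {Γ = []} {Δ = [ (A , δ) ]} {β = 0 ∷ 1 ∷ []}
      (trans-M α (0 ∷ 1 ∷ []) [] [ (A , δ) ] (λ ()) (occupied (here refl))) (axiom A δ)
    atγ₁ : Derivable M [ P ] [ (A , γ ++ [ 1 ]) ]
    atγ₁ = subst (λ ε → Derivable M [ P ] [ (A , ε) ]) (sym (++-assoc α [ 0 ] [ 1 ])) atδ
    fresh₁ : FreshIn (γ ++ [ 1 ]) [ P ]
    fresh₁ (_ , here refl , ε , eq) =
      extension-not-prefix α 0 (1 ∷ ε) (trans (sym (++-assoc γ [ 1 ] ε)) eq)

open Derivations

-- □A → ◇A in D: instantiate □A and witness ◇A at the same successor α ∘ 0.
derive-axD : ∀ A α → Derivable D [] [ (□ A ⇒ ◇ A , α) ]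
derive-axD A α =
  ⇒R {Γ = []} (□L {Γ = []} {Δ = [ (◇ A , α) ]} {β = [ 0 ]} (0 , refl)
    (◇R {Γ = [ (A , α ++ [ 0 ]) ]} {Δ = []} {β = [ 0 ]} (0 , refl) (axiom A (α ++ [ 0 ]))))

embedding : ∀ M A → ⊢H M A → ∀ α → Derivable M [] [ (A , α) ]
embedding .D  _ (extra (axD A))   α = derive-axD A α
embedding .T  _ (extra (axT A))   α = derive-axT T-reflexive A α
embedding .K4 _ (extra (ax4 A))   α = derive-ax4 K4-transitive A α
embedding .S4 _ (extra (axS4T A)) α = derive-axT S4-reflexive A α
embedding .S4 _ (extra (axS44 A)) α = derive-ax4 S4-transitive A α
embedding M _ (ax1 A B)   α = derive-ax1 A B α
embedding M _ (ax2 A B C) α = derive-ax2 A B C α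
embedding M _ (ax3 A B)   α = derive-ax3 A B α
embedding M _ (axK A B)   α = derive-axK A B α
embedding M B (mp {A} ⊢A⇒B ⊢A) α = derived-mp A B α (embedding M _ ⊢A⇒B α) (embedding M A ⊢A α)
embedding M _ (nec {A} ⊢A)     α = derived-nec A α (embedding M A ⊢A (α ++ [ 0 ]))

mainTheorem4 : (M : Sys) (A : Formula) → ⊢H M A → Derivable M [] [ (A , []) ]
mainTheorem4 M A ⊢A = embedding M A ⊢A []
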